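{- For every $m\ge 2$, the following program returns $G=R_m$: set $G=[\ ]$; for $c=1$ to $2^{m-1}-1$, let $v=v_2(c)$, let $h$ be the Hamming weight of $c$ (number of ones in its binary expansion), set $d=m-v-h$, and append $[d,d+1,\ldots,d+v]$ to $G$; return $G$.
   Context: $v_2(c)$ denotes the largest integer $v$ such that $2^v$ divides $c$. The sequences $R_m$ are defined by $R_2=[1]$ and $R_m=(R_{m-1}+1)\cup[1,2,\ldots,m-1]\cup R_{m-1}$ for $m\ge3$, where $\cup$ is concatenation and $R_{m-1}+1$ adds $1$ to each entry. -}

module Defs where

open import Data.Nat using (ℕ; zero; suc; _+_; _∸_; _^_)
open import Data.Nat.DivMod using (_/_; _%_)
open import Data.List using (List; []; _∷_; _++_; map; concatMap; upTo)

-- 2-adic valuation v₂(c) for c ≥ 1 (with fuel; fuel = c suffices).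
-- v₂ 0 is set to 0 by convention (never used below).
v₂-aux : ℕ → ℕ → ℕ
v₂-aux zero    c = 0
v₂-aux (suc f) zero = 0
v₂-aux (suc f) c@(suc _) with c % 2
... | zero  = suc (v₂-aux f (c / 2))
... | suc _ = 0

v₂ : ℕ → ℕ
v₂ c = v₂-aux c c

ham-aux : ℕ → ℕ → ℕ
ham-aux zero    c = 0
ham-aux (suc f) c = c % 2 + ham-aux f (c / 2)

hammingWeight : ℕ → ℕ
hammingWeight c = ham-aux c c

oneTo : ℕ → List ℕ
oneTo n = map suc (upTo n)

-- R_m indexed by k with R k = R_{k+2}:
-- R_2 = [1],  R_m = (R_{m-1} + 1) ++ [1..m-1] ++ R_{m-1}.
R' : ℕ → List ℕ
R' zero    = 1 ∷ []
R' (suc k) = map suc (R' k) ++ oneTo (suc (suc k)) ++ R' k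

-- R m = R_m for m ≥ 2 (R 0 and R 1 are junk values, never used).
R : ℕ → List ℕ
R m = R' (m ∸ 2)

block : ℕ → ℕ → List ℕ
block d v = map (d +_) (upTo (suc v))

program : ℕ → List ℕ
program m = concatMap step (map suc (upTo (2 ^ (m ∸ 1) ∸ 1)))
  where
  step : ℕ → List ℕ
  step c = block (m ∸ v₂ c ∸ hammingWeight c) (v₂ c)

module Submission where

-- The program visits c = 1, …, 2^(m-1) - 1 and the block it appends for c
-- depends only on the signature (v₂ c , hammingWeight c).  Write
-- S_j for the list of signatures of 1, …, 2^j - 1.  Splitting the range at
-- 2^j (the new top bit) gives the recursion
--     S_(j+1) = S_j ++ [(j , 1)] ++ (S_j with every weight increased by 1),
-- because adding a top bit 2^j to c < 2^j keeps v₂ and raises the weight.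
-- Running the program with parameter m over a list of signatures is a
-- concatMap, so it distributes over ++; raising m by one adds 1 to every
-- entry (when all v + h ≤ m), while raising m together with the weights
-- changes nothing.  With m = k + 3 the three parts of S_(k+2) therefore
-- yield R_(k+2) + 1, the block [1 .. k+2] and R_(k+2), which is the
-- defining recursion of R_(k+3).

open import Defs
open import Data.Nat
open import Data.Nat.Properties
open import Data.Nat.DivMod
open import Data.Nat.Divisibility using (divides-refl)
open import Relation.Binary.PropositionalEquality
open import Function using (_∘_)
open import Data.Product using (_×_; _,_)
open import Data.List using (List; []; _∷_; _++_; map; concatMap; upTo; applyUpTo)
open import Data.List.Properties using (map-++; map-∘; map-upTo; map-applyUpTo; concatMap-++; concatMap-map; concatMap-cong)
open import Data.List.Relation.Unary.All as All using (All; []; _∷_)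
open import Data.List.Relation.Unary.All.Properties using (++⁺; map⁺)
open ≡-Reasoning

double%2 : ∀ q → 2 * q % 2 ≡ 0
double%2 q rewrite *-comm 2 q = m*n%n≡0 q 2

double/2 : ∀ q → 2 * q / 2 ≡ q
double/2 q rewrite *-comm 2 q = m*n/n≡m q 2

odd%2 : ∀ q → (1 + 2 * q) % 2 ≡ 1
odd%2 q rewrite *-comm 2 q = [m+kn]%n≡m%n 1 q 2

odd/2 : ∀ q → (1 + 2 * q) / 2 ≡ q
odd/2 q rewrite *-comm 2 q = trans (+-distrib-/-∣ʳ 1 {d = 2} (divides-refl q)) (m*n/n≡m q 2)

-- Halving a positive number makes it smaller; this is what makes fuel c
-- sufficient for the digit recursions on c.
half≤pred : ∀ c → suc c / 2 ≤ c
half≤pred c = ≤-pred (m/n<m (suc c) 2 (s≤s (s≤s z≤n)))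

v₂-aux-fuel : ∀ f g c → c ≤ f → c ≤ g → v₂-aux f c ≡ v₂-aux g c
v₂-aux-fuel zero    zero    zero    _ _ = refl
v₂-aux-fuel zero    (suc g) zero    _ _ = refl
v₂-aux-fuel (suc f) zero    zero    _ _ = refl
v₂-aux-fuel (suc f) (suc g) zero    _ _ = refl
v₂-aux-fuel (suc f) (suc g) (suc c) (s≤s c≤f) (s≤s c≤g) with suc c % 2
... | zero  = cong suc (v₂-aux-fuel f g (suc c / 2) (≤-trans (half≤pred c) c≤f) (≤-trans (half≤pred c) c≤g))
... | suc _ = refl

ham-aux-fuel : ∀ f g c → c ≤ f → c ≤ g → ham-aux f c ≡ ham-aux g c
ham-aux-fuel zero    zero    zero    _ _ = refl
ham-aux-fuel zero    (suc g) zero    _ _ = ham-aux-fuel zero g zero z≤n z≤n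
ham-aux-fuel (suc f) zero    zero    _ _ = ham-aux-fuel f zero zero z≤n z≤n
ham-aux-fuel (suc f) (suc g) zero    _ _ = ham-aux-fuel f g zero z≤n z≤n
ham-aux-fuel (suc f) (suc g) (suc c) (s≤s c≤f) (s≤s c≤g) =
  cong (suc c % 2 +_) (ham-aux-fuel f g (suc c / 2) (≤-trans (half≤pred c) c≤f) (≤-trans (half≤pred c) c≤g))

v₂-aux-even : ∀ f c → 1 ≤ c → c ≤ f → c % 2 ≡ 0 → v₂-aux f c ≡ suc (v₂ (c / 2))
v₂-aux-even (suc f) (suc c) _ (s≤s c≤f) even with suc c % 2 | even
... | zero | _ = cong suc (v₂-aux-fuel f (suc c / 2) (suc c / 2) (≤-trans (half≤pred c) c≤f) ≤-refl)

v₂-aux-odd : ∀ f c → 1 ≤ c → c ≤ f → c % 2 ≡ 1 → v₂-aux f c ≡ 0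
v₂-aux-odd (suc f) (suc c) _ _ odd with suc c % 2 | odd
... | suc _ | _ = refl

ham-aux-step : ∀ f c → 1 ≤ c → c ≤ f → ham-aux f c ≡ c % 2 + hammingWeight (c / 2)
ham-aux-step (suc f) (suc c) _ (s≤s c≤f) =
  cong (suc c % 2 +_) (ham-aux-fuel f (suc c / 2) (suc c / 2) (≤-trans (half≤pred c) c≤f) ≤-refl)

1≤double : ∀ c → 1 ≤ c → 1 ≤ 2 * c
1≤double c 1≤c = ≤-trans 1≤c (m≤m+n c (c + 0))

v₂-double : ∀ c → 1 ≤ c → v₂ (2 * c) ≡ suc (v₂ c)
v₂-double c 1≤c = begin
  v₂ (2 * c)              ≡⟨ v₂-aux-even (2 * c) (2 * c) (1≤double c 1≤c) ≤-refl (double%2 c) ⟩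
  suc (v₂ (2 * c / 2))    ≡⟨ cong (suc ∘ v₂) (double/2 c) ⟩
  suc (v₂ c)              ∎

v₂-odd : ∀ q → v₂ (1 + 2 * q) ≡ 0
v₂-odd q = v₂-aux-odd (1 + 2 * q) (1 + 2 * q) (s≤s z≤n) ≤-refl (odd%2 q)

weight-double : ∀ c → hammingWeight (2 * c) ≡ hammingWeight c
weight-double zero      = refl
weight-double c@(suc _) = begin
  hammingWeight (2 * c)                      ≡⟨ ham-aux-step (2 * c) (2 * c) (1≤double c (s≤s z≤n)) ≤-refl ⟩
  2 * c % 2 + hammingWeight (2 * c / 2)      ≡⟨ cong₂ _+_ (double%2 c) (cong hammingWeight (double/2 c)) ⟩
  hammingWeight c                            ∎

weight-odd : ∀ q → hammingWeight (1 + 2 * q) ≡ suc (hammingWeight q)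
weight-odd q = begin
  hammingWeight (1 + 2 * q)                          ≡⟨ ham-aux-step (1 + 2 * q) (1 + 2 * q) (s≤s z≤n) ≤-refl ⟩
  (1 + 2 * q) % 2 + hammingWeight ((1 + 2 * q) / 2)  ≡⟨ cong₂ _+_ (odd%2 q) (cong hammingWeight (odd/2 q)) ⟩
  suc (hammingWeight q)                              ∎

v₂-pow : ∀ j → v₂ (2 ^ j) ≡ j
v₂-pow zero    = refl
v₂-pow (suc j) = trans (v₂-double (2 ^ j) (m^n>0 2 j)) (cong suc (v₂-pow j))

weight-pow : ∀ j → hammingWeight (2 ^ j) ≡ 1
weight-pow zero    = refl
weight-pow (suc j) = trans (weight-double (2 ^ j)) (weight-pow j)

data LowBit : ℕ → Set where
  twice   : ∀ q → LowBit (2 * q)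
  twice+1 : ∀ q → LowBit (1 + 2 * q)

lowBit : ∀ c → LowBit c
lowBit zero = twice 0
lowBit (suc c) with lowBit c
... | twice q   = twice+1 q
... | twice+1 q = subst LowBit (cong suc (+-suc q (q + 0))) (twice (suc q))

top-twice : ∀ a q → 2 * a + 2 * q ≡ 2 * (a + q)
top-twice a q = sym (*-distribˡ-+ 2 a q)

top-twice+1 : ∀ a q → 2 * a + (1 + 2 * q) ≡ 1 + 2 * (a + q)
top-twice+1 a q = trans (+-suc (2 * a) (2 * q)) (cong suc (top-twice a q))

1≤half : ∀ q → 1 ≤ 2 * q → 1 ≤ q
1≤half (suc _) _ = s≤s z≤n

half<-twice : ∀ q b → 2 * q < 2 * b → q < b
half<-twice q b = *-cancelˡ-< 2 q b

half<-twice+1 : ∀ q b → 1 + 2 * q < 2 * b → q < b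
half<-twice+1 q b lt = half<-twice q b (<-trans (n<1+n (2 * q)) lt)

v₂-top : ∀ j c → 1 ≤ c → c < 2 ^ j → v₂ (2 ^ j + c) ≡ v₂ c
v₂-top zero    (suc c) _ (s≤s ())
v₂-top (suc j) c 1≤c c<2^j+1 with lowBit c
... | twice q = begin
  v₂ (2 * 2 ^ j + 2 * q)     ≡⟨ cong v₂ (top-twice (2 ^ j) q) ⟩
  v₂ (2 * (2 ^ j + q))       ≡⟨ v₂-double (2 ^ j + q) (≤-trans 1≤q (m≤n+m q (2 ^ j))) ⟩
  suc (v₂ (2 ^ j + q))       ≡⟨ cong suc (v₂-top j q 1≤q (half<-twice q (2 ^ j) c<2^j+1)) ⟩
  suc (v₂ q)                 ≡⟨ sym (v₂-double q 1≤q) ⟩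
  v₂ (2 * q)                 ∎
  where
  1≤q : 1 ≤ q
  1≤q = 1≤half q 1≤c
... | twice+1 q = begin
  v₂ (2 * 2 ^ j + (1 + 2 * q))  ≡⟨ cong v₂ (top-twice+1 (2 ^ j) q) ⟩
  v₂ (1 + 2 * (2 ^ j + q))      ≡⟨ v₂-odd (2 ^ j + q) ⟩
  0                             ≡⟨ sym (v₂-odd q) ⟩
  v₂ (1 + 2 * q)                ∎

weight-top : ∀ j c → c < 2 ^ j → hammingWeight (2 ^ j + c) ≡ suc (hammingWeight c)
weight-top zero    zero    _ = refl
weight-top zero    (suc c) (s≤s ())
weight-top (suc j) c c<2^j+1 with lowBit c
... | twice q = begin
  hammingWeight (2 * 2 ^ j + 2 * q)  ≡⟨ cong hammingWeight (top-twice (2 ^ j) q) ⟩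
  hammingWeight (2 * (2 ^ j + q))    ≡⟨ weight-double (2 ^ j + q) ⟩
  hammingWeight (2 ^ j + q)          ≡⟨ weight-top j q (half<-twice q (2 ^ j) c<2^j+1) ⟩
  suc (hammingWeight q)              ≡⟨ cong suc (sym (weight-double q)) ⟩
  suc (hammingWeight (2 * q))        ∎
... | twice+1 q = begin
  hammingWeight (2 * 2 ^ j + (1 + 2 * q))  ≡⟨ cong hammingWeight (top-twice+1 (2 ^ j) q) ⟩
  hammingWeight (1 + 2 * (2 ^ j + q))      ≡⟨ weight-odd (2 ^ j + q) ⟩
  suc (hammingWeight (2 ^ j + q))          ≡⟨ cong suc (weight-top j q (half<-twice+1 q (2 ^ j) c<2^j+1)) ⟩
  suc (suc (hammingWeight q))              ≡⟨ cong suc (sym (weight-odd q)) ⟩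
  suc (hammingWeight (1 + 2 * q))          ∎

applyUpTo-+ : ∀ {A : Set} (f : ℕ → A) n k → applyUpTo f (n + k) ≡ applyUpTo f n ++ applyUpTo (f ∘ (n +_)) k
applyUpTo-+ f zero    k = refl
applyUpTo-+ f (suc n) k = cong (f 0 ∷_) (applyUpTo-+ (f ∘ suc) n k)

applyUpTo-cong : ∀ {A : Set} (f g : ℕ → A) n → (∀ {i} → i < n → f i ≡ g i) → applyUpTo f n ≡ applyUpTo g n
applyUpTo-cong f g zero    eq = refl
applyUpTo-cong f g (suc n) eq = cong₂ _∷_ (eq z<s) (applyUpTo-cong (f ∘ suc) (g ∘ suc) n (eq ∘ s<s))

Signature : Set
Signature = ℕ × ℕ

signature : ℕ → Signature
signature c = v₂ c , hammingWeight c

signatures : ℕ → List Signature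
signatures j = applyUpTo (signature ∘ suc) (2 ^ j ∸ 1)

addBit : Signature → Signature
addBit (v , h) = v , suc h

signature-top : ∀ j c → 1 ≤ c → c < 2 ^ j → signature (2 ^ j + c) ≡ addBit (signature c)
signature-top j c 1≤c c<2^j = cong₂ _,_ (v₂-top j c 1≤c c<2^j) (weight-top j c c<2^j)

signature-pow : ∀ j → signature (2 ^ j) ≡ (j , 1)
signature-pow j = cong₂ _,_ (v₂-pow j) (weight-pow j)

signatures-suc : ∀ j → signatures (suc j) ≡ signatures j ++ (j , 1) ∷ map addBit (signatures j)
signatures-suc j = begin
  applyUpTo F (2 ^ suc j ∸ 1)
    ≡⟨ cong (applyUpTo F) length-split ⟩
  applyUpTo F (n + suc n)
    ≡⟨ applyUpTo-+ F n (suc n) ⟩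
  applyUpTo F n ++ F (n + 0) ∷ applyUpTo (λ i → F (n + suc i)) n
    ≡⟨ cong₂ (λ x xs → applyUpTo F n ++ x ∷ xs) middle upper ⟩
  applyUpTo F n ++ (j , 1) ∷ map addBit (applyUpTo F n)
    ∎
  where
  F : ℕ → Signature
  F = signature ∘ suc
  n : ℕ
  n = 2 ^ j ∸ 1
  2^j≡1+n : 2 ^ j ≡ suc n
  2^j≡1+n = sym (trans (+-comm 1 n) (m∸n+n≡m (m^n>0 2 j)))
  length-split : 2 ^ suc j ∸ 1 ≡ n + suc n
  length-split rewrite 2^j≡1+n = cong (n +_) (+-identityʳ (suc n))
  middle : F (n + 0) ≡ (j , 1)
  middle = begin
    signature (suc (n + 0))  ≡⟨ cong (signature ∘ suc) (+-identityʳ n) ⟩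
    signature (suc n)        ≡⟨ cong signature (sym 2^j≡1+n) ⟩
    signature (2 ^ j)        ≡⟨ signature-pow j ⟩
    (j , 1)                  ∎
  above : ∀ {i} → i < n → F (n + suc i) ≡ addBit (F i)
  above {i} i<n = begin
    signature (suc n + suc i)   ≡⟨ cong (λ a → signature (a + suc i)) (sym 2^j≡1+n) ⟩
    signature (2 ^ j + suc i)   ≡⟨ signature-top j (suc i) (s≤s z≤n) (subst (suc i <_) (sym 2^j≡1+n) (s≤s i<n)) ⟩
    addBit (F i)                ∎
  upper : applyUpTo (λ i → F (n + suc i)) n ≡ map addBit (applyUpTo F n)
  upper = trans (applyUpTo-cong _ (addBit ∘ F) n above) (sym (map-applyUpTo F addBit n))

Fits : ℕ → Signature → Set
Fits n (v , h) = v + h ≤ n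

Fits-weaken : ∀ {n} p → Fits n p → Fits (suc n) p
Fits-weaken _ = m≤n⇒m≤1+n

Fits-addBit : ∀ {n} p → Fits n p → Fits (suc n) (addBit p)
Fits-addBit (v , h) v+h≤n = ≤-trans (≤-reflexive (+-suc v h)) (s≤s v+h≤n)

signatures-fit : ∀ j → All (Fits j) (signatures j)
signatures-fit zero    = []
signatures-fit (suc j) rewrite signatures-suc j =
  ++⁺ (All.map (λ {p} → Fits-weaken p) (signatures-fit j))
      (≤-reflexive (+-comm j 1) ∷ map⁺ (All.map (λ {p} → Fits-addBit p) (signatures-fit j)))

blockOf : ℕ → Signature → List ℕ
blockOf m (v , h) = block (m ∸ v ∸ h) v

run : ℕ → List Signature → List ℕ
run m = concatMap (blockOf m)

program-signatures : ∀ m → program m ≡ run m (signatures (m ∸ 1))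
program-signatures m = begin
  concatMap (blockOf m ∘ signature) (map suc (upTo N))
    ≡⟨ cong (concatMap (blockOf m ∘ signature)) (map-upTo suc N) ⟩
  concatMap (blockOf m ∘ signature) (applyUpTo suc N)
    ≡⟨ concatMap-map (blockOf m) signature (applyUpTo suc N) ⟨
  run m (map signature (applyUpTo suc N))
    ≡⟨ cong (run m) (map-applyUpTo suc signature N) ⟩
  run m (applyUpTo (signature ∘ suc) N)
    ∎
  where
  N : ℕ
  N = 2 ^ (m ∸ 1) ∸ 1

blockOf-raise : ∀ n p → Fits n p → blockOf (suc n) p ≡ map suc (blockOf n p)
blockOf-raise n (v , h) v+h≤n = begin
  block (suc n ∸ v ∸ h) v        ≡⟨ cong (λ d → block d v) start ⟩
  block (suc (n ∸ v ∸ h)) v      ≡⟨ map-∘ (upTo (suc v)) ⟩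
  map suc (block (n ∸ v ∸ h) v)  ∎
  where
  start : suc n ∸ v ∸ h ≡ suc (n ∸ v ∸ h)
  start = begin
    suc n ∸ v ∸ h      ≡⟨ ∸-+-assoc (suc n) v h ⟩
    suc n ∸ (v + h)    ≡⟨ +-∸-assoc 1 v+h≤n ⟩
    suc (n ∸ (v + h))  ≡⟨ cong suc (∸-+-assoc n v h) ⟨
    suc (n ∸ v ∸ h)    ∎

run-raise : ∀ n xs → All (Fits n) xs → run (suc n) xs ≡ map suc (run n xs)
run-raise n []       []              = refl
run-raise n (p ∷ xs) (p-fits ∷ fits) = begin
  blockOf (suc n) p ++ run (suc n) xs          ≡⟨ cong₂ _++_ (blockOf-raise n p p-fits) (run-raise n xs fits) ⟩
  map suc (blockOf n p) ++ map suc (run n xs)  ≡⟨ map-++ suc (blockOf n p) (run n xs) ⟨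
  map suc (run n (p ∷ xs))                     ∎

blockOf-addBit : ∀ n p → blockOf (suc n) (addBit p) ≡ blockOf n p
blockOf-addBit n (v , h) = cong (λ d → block d v) (begin
  suc n ∸ v ∸ suc h      ≡⟨ ∸-+-assoc (suc n) v (suc h) ⟩
  suc n ∸ (v + suc h)    ≡⟨ cong (suc n ∸_) (+-suc v h) ⟩
  n ∸ (v + h)            ≡⟨ ∸-+-assoc n v h ⟨
  n ∸ v ∸ h              ∎)

run-addBit : ∀ n xs → run (suc n) (map addBit xs) ≡ run n xs
run-addBit n xs = trans (concatMap-map (blockOf (suc n)) addBit xs) (concatMap-cong (blockOf-addBit n) xs)

blockOf-pow : ∀ k → blockOf (3 + k) (suc k , 1) ≡ oneTo (2 + k)
blockOf-pow k = cong (λ d → block (d ∸ 1) (suc k)) (m+n∸n≡m 2 k)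

run-signatures : ∀ k → run (2 + k) (signatures (1 + k)) ≡ R' k
run-signatures zero    = refl
run-signatures (suc k) = begin
  run (suc m) (signatures (suc j))
    ≡⟨ cong (run (suc m)) (signatures-suc j) ⟩
  run (suc m) (S ++ (j , 1) ∷ map addBit S)
    ≡⟨ concatMap-++ (blockOf (suc m)) S _ ⟩
  run (suc m) S ++ blockOf (suc m) (j , 1) ++ run (suc m) (map addBit S)
    ≡⟨ cong₂ (λ a b → a ++ blockOf (suc m) (j , 1) ++ b) (run-raise m S S-fits) (run-addBit m S) ⟩
  map suc (run m S) ++ blockOf (suc m) (j , 1) ++ run m S
    ≡⟨ cong₂ (λ r b → map suc r ++ b ++ r) (run-signatures k) (blockOf-pow k) ⟩
  map suc (R' k) ++ oneTo m ++ R' k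
    ∎
  where
  j m : ℕ
  j = suc k
  m = suc j
  S : List Signature
  S = signatures j
  S-fits : All (Fits m) S
  S-fits = All.map (λ {p} → Fits-weaken p) (signatures-fit j)

theorem4p1 : (m : ℕ) → m ≥ 2 → program m ≡ R m
theorem4p1 (suc (suc k)) _         = trans (program-signatures (2 + k)) (run-signatures k)
theorem4p1 (suc zero)    (s≤s ())
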